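{- Let $n \geq 1$ and $0 \leq m \leq n-1$ such that either $m$ is even or $m = n-1$. Let $C: \omega^{(1)} < \cdots < \omega^{(k)}$ be a chain in $P_{n,m}$ with $k$ elements and let $I \subseteq [k]$; let $C_I$ be the subchain of $C$ obtained by removing $\omega^{(i)}$ for all $i \in I$. Let $\omega$ be the top element of $C$ and $\omega_I$ the top element of $C_I$ (with $\omega_I = 0^n$ if $C_I$ is empty). Then $\Phi(C_I) = \Phi(C)$ if and only if $\{\ell(C,i) : i \in I\} \cap \operatorname{Des}(\Phi(C)) = \emptyset$ and $\operatorname{BAR}(\omega_I) = \operatorname{BAR}(\omega)$.
   Context: Sign vectors: elements of $\{ -,0,+\}^n$. For a sign vector $\omega$, $\operatorname{var}(\omega)$ is the number of sign changes in the sequence obtained from $\omega$ by deleting its zero entries. $\mathcal{PV}_n$ is the set of nonzero sign vectors of length $n$ modulo $\omega \sim -\omega$. For $0 \leq m < n$, $P_{n,m}$ is the poset on $\{\omega \in \mathcal{PV}_n : \operatorname{var}(\omega) \leq m\}$ with $\omega' < \omega$ iff $\omega'$ or $-\omega'$ is obtained from $\omega$ by replacing some nonzero entries with $0$. $\Delta_{n,m}$ is the order complex of $P_{n,m}$ (faces = chains). Cyclic sign flips: indices are read cyclically ($\omega_{i+n} = \omega_i$); $i \in [n]$ is a cyclic sign flip of $\omega$ if there is $j \geq 1$ with $\omega_{i-j}\omega_i < 0$ and $\omega_{i-k}\omega_i = 0$ for $1 \leq k < j$. $\operatorname{BAR}(\omega)$ is the set of cyclic sign flips; $\operatorname{BAR}(0^n)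 = \emptyset$. Signed permutations: bijections $\pi$ of $\{\pm 1, \dots, \pm n\}$ with $\pi(-i) = -\pi(i)$, in window notation $\pi(1)\cdots\pi(n)$. With $w_0 = 0$, $w_i = \pi(i)$, $\operatorname{Des}(\pi) = \{i \in \{0, \dots, n-1\} : w_i > w_{i+1}\}$. The map $\Phi$: for a chain $C: \omega^{(1)} < \cdots < \omega^{(r)}$ set $\omega^{(0)} = 0^n$. For $s = 1, \dots, r$ let $I_s = \{i \in [n] : \omega^{(s)}_i \neq 0, \omega^{(s-1)}_i = 0\}$, and $I_{r+1} = \{i \in [n] : \omega^{(r)}_i = 0\}$. For $1 \leq s \leq r+1$ let $\bar{I}_s = \{i : i \in I_s, i \notin \operatorname{BAR}(\omega^{(r)})\} \cup \{ -i : i \in I_s, i \in \operatorname{BAR}(\omega^{(r)})\}$, and $\omega'_s$ the word listing $\bar{I}_s$ in increasing order. Then $\Phi(C)$ is the signed permutation with window notation $\omega'_{r+1}\cdots\omega'_1$. For $0 \leq i \leq r+1$, $\ell(C,i) = |\bigcup_{j > i} I_j|$. -}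

module Defs where

open import Data.Bool using (Bool; true; false; if_then_else_; not; _∧_)
open import Data.Nat using (ℕ; zero; suc; _+_; _*_; _∸_; _≤_; _<_)
open import Data.Nat.DivMod using (_%_; m%n<n)
open import Data.Fin using (Fin; toℕ; fromℕ<)
open import Data.Fin.Subset using (Subset; _∈_)
open import Data.Vec using (Vec; []; _∷_; lookup; tabulate; replicate; toList)
open import Data.List using (List; []; _∷_; filter; map; concat; drop; length; reverse; _++_)
open import Data.List.Base using (allFin)
open import Data.Integer using (ℤ; +_; -_; _<_)
open import Data.Integer.Properties using (≤-decTotalOrder)
open import Data.List.Sort ≤-decTotalOrder using (sort)
open import Data.Product using (Σ; _×_; _,_)
open import Data.Sum using (_⊎_)
open import Data.Empty using (⊥)
open import Data.Unit using (⊤)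
open import Relation.Binary.PropositionalEquality using (_≡_; _≢_)
open import Relation.Nullary using (¬_)
open import Relation.Nullary.Decidable using (does)

-- Signs and sign vectors (positions are 0-based: Fin n stands for [n])

data Sign : Set where
  neg zer pos : Sign

negate : Sign → Sign
negate neg = pos
negate zer = zer
negate pos = neg

isZero : Sign → Bool
isZero zer = true
isZero _   = false

oppositeSigns : Sign → Sign → Bool
oppositeSigns neg pos = true
oppositeSigns pos neg = true
oppositeSigns _   _   = false

SignVec : ℕ → Set
SignVec n = Vec Sign n

zeroVec : (n : ℕ) → SignVec n
zeroVec n = replicate n zer

negVec : ∀ {n} → SignVec n → SignVec n
negVec ω = Data.Vec.map negate ω

varList : Sign → List Sign → ℕ      -- first argument: last nonzero sign seen
varList _ [] = 0
varList s (zer ∷ xs) = varList s xs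
varList s (t ∷ xs) = (if oppositeSigns s t then 1 else 0) + varList t xs

var : ∀ {n} → SignVec n → ℕ
var ω = varList zer (toList ω)

-- The poset P_{n,m} on representatives (ω ∼ -ω).
-- ω' is obtained from ω by replacing some nonzero entries by 0:
ZeroingOf : ∀ {n} → SignVec n → SignVec n → Set
ZeroingOf ω' ω = ∀ i → (lookup ω' i ≡ zer) ⊎ (lookup ω' i ≡ lookup ω i)

_≺_ : ∀ {n} → SignVec n → SignVec n → Set
ω' ≺ ω = (ZeroingOf ω' ω ⊎ ZeroingOf (negVec ω') ω)
         × Σ _ (λ i → (lookup ω' i ≡ zer) × (lookup ω i ≢ zer))

NonZeroVec : ∀ {n} → SignVec n → Set
NonZeroVec {n} ω = ω ≢ zeroVec n

InP : (n m : ℕ) → SignVec n → Set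
InP n m ω = NonZeroVec ω × var ω ≤ m

-- ascending chain ω(1) < ... < ω(k), given as a list bottom-to-top
ChainFrom : ∀ {n} → SignVec n → List (SignVec n) → Set
ChainFrom ω [] = ⊤
ChainFrom ω (ω' ∷ ws) = (ω ≺ ω') × ChainFrom ω' ws

IsChain : (n m : ℕ) → List (SignVec n) → Set
IsChain n m [] = ⊤
IsChain n m (ω ∷ ws) = InP n m ω × AllInP ws × ChainFrom ω ws
  where
  AllInP : List (SignVec n) → Set
  AllInP [] = ⊤
  AllInP (x ∷ xs) = InP n m x × AllInP xs

top : ∀ {n} → List (SignVec n) → SignVec n
top {n} [] = zeroVec n
top (ω ∷ []) = ω
top (_ ∷ ω ∷ ws) = top (ω ∷ ws)

cyc : ∀ {n} → SignVec n → ℕ → Sign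
cyc {zero} ω k = zer
cyc {suc n} ω k = lookup ω (fromℕ< (m%n<n k (suc n)))

-- search j = j₀, j₀+1, …, (fuel steps) for the first j with ω_{i-j} ≠ 0
-- and report whether ω_{i-j} ω_i < 0.  Index i - j is taken as i + (n-1) j.
flipSearch : ∀ {n} → SignVec n → (i : ℕ) → Sign → (j fuel : ℕ) → Bool
flipSearch ω i s j zero = false
flipSearch {n} ω i s j (suc fuel) with cyc ω (i + (n ∸ 1) * j)
... | zer = flipSearch ω i s (suc j) fuel
... | t   = oppositeSigns t s

-- i is a cyclic sign flip of ω.  (For j ≥ n no new cases arise: at j = n
-- the entry is ω_i itself, so searching j = 1..n is exhaustive.)
isFlip : ∀ {n} → SignVec n → Fin n → Bool
isFlip {n} ω i = flipSearch ω (toℕ i) (lookup ω i) 1 n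

BAR : ∀ {n} → SignVec n → Subset n
BAR ω = tabulate (isFlip ω)

-- The map Φ.  Output: window notation π(1)⋯π(n) as a list of integers.

-- I_s for s = 1..r, then I_{r+1}; argument: previous element
blocksFrom : ∀ {n} → SignVec n → List (SignVec n) → List (List (Fin n))
blocksFrom {n} prev [] =
  filter (λ i → Data.Bool._≟_ (isZero (lookup prev i)) true) (allFin n) ∷ []
blocksFrom {n} prev (ω ∷ ws) =
  filter (λ i → Data.Bool._≟_ (not (isZero (lookup ω i)) ∧ isZero (lookup prev i)) true)
         (allFin n)
  ∷ blocksFrom ω ws

blocks : ∀ {n} → List (SignVec n) → List (List (Fin n))
blocks {n} C = blocksFrom (zeroVec n) C

-- signed label of position i (value i+1 in 1-based notation)
signedLabel : ∀ {n} → Subset n → Fin n → ℤ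
signedLabel bar i = if lookup bar i then - (+ suc (toℕ i)) else + suc (toℕ i)

Φ : ∀ {n} → List (SignVec n) → List ℤ
Φ C = concat (reverse (map (λ I → sort (map (signedLabel (BAR (top C))) I)) (blocks C)))

ℓ : ∀ {n} → List (SignVec n) → ℕ → ℕ
ℓ C i = length (concat (drop i (blocks C)))

-- Descent set with w₀ = 0:  d ∈ Des(π) iff d ∈ {0..n-1} and w_d > w_{d+1}

DesAt : List ℤ → ℕ → Set
DesAt (x ∷ y ∷ rest) zero = y Data.Integer.< x
DesAt (x ∷ rest) (suc d) = DesAt rest d
DesAt _ _ = ⊥

InDes : List ℤ → ℕ → Set
InDes π d = DesAt (+ 0 ∷ π) d

-- Subchain C_I: remove the i-th element (1-based i+1) for i ∈ I

removeIdx : ∀ {A : Set} {k} → Subset k → Vec A k → List A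
removeIdx [] [] = []
removeIdx (true ∷ I) (x ∷ xs) = removeIdx I xs
removeIdx (false ∷ I) (x ∷ xs) = x ∷ removeIdx I xs

Even : ℕ → Set
Even m = Σ ℕ (λ t → m ≡ 2 * t)

module Submission where

-- Φ(C) is the `stack` of the blocks I₁,…,I_{k+1} of C: positions are labelled
-- by the signs of BAR(top C), each block is sorted, and the blocks are
-- concatenated from I_{k+1} down to I₁ (Φ-as-stack).  Removing ω^(i) merges
-- I_i with I_{i+1}, so:
--  (1) the blocks of C_I are, up to order inside blocks, the blocks of C
--      merged along I (subchain-blocks);
--  (2) a merge leaves the stack unchanged iff at each merge point the two
--      sorted blocks, side by side, are sorted (merge-stack);
--  (3) such a join is sorted iff the stack has no descent there, i.e. at
--      ℓ(C,i); the exception is a join at position 0 onto an empty last block,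
--      where the sign of the next entry decides (TopEdge);
--  (4) Φ(C_I) = Φ(C) forces BAR(top C_I) = BAR(top C), since every position
--      occurs in Φ with the sign recorded by BAR (Φ-determines-BAR); zero
--      entries are never sign flips, which settles the join at position 0.
-- The general list and sorting facts come first, then the chain-specific
-- facts (module Chain), and the theorem combines them.

open import Defs
open import Data.Nat using (ℕ; suc; _≤_; _<_; _∸_)
open import Data.Fin using (Fin; toℕ)
open import Data.Fin.Subset using (Subset; _∈_)
open import Data.Vec using (Vec; toList)
open import Data.Sum using (_⊎_)
open import Data.Product using (_×_)
open import Relation.Binary.PropositionalEquality using (_≡_)
open import Relation.Nullary using (¬_)
open import Function.Bundles using (_⇔_)

open import Data.Bool as Bool using (Bool; true; false; not; _∧_; _∨_)
open import Data.Nat as ℕ using (zero; _+_; s≤s; z≤n)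
import Data.Nat.Properties as ℕP
import Data.Fin as Fin
import Data.Fin.Properties as FinP
open import Data.Vec as V using (lookup; _[_]=_; here; there)
import Data.Vec.Properties as VP
open import Data.List using (List; []; _∷_; _++_; length; drop; map; concat; reverse; filter)
open import Data.List.Base using (allFin)
open import Data.List.Properties
  using (∷-injective; ++-assoc; length-++; ++-identityʳ; map-++; length-map; drop-map; unfold-reverse; concat-++)
open import Data.List.Relation.Unary.Linked using (Linked; []; [-]; _∷_)
open import Data.List.Relation.Unary.Any using (here; there)
open import Data.List.Relation.Binary.Pointwise as Pointwise using (Pointwise; []; _∷_)
open import Data.List.Relation.Binary.Permutation.Propositional using (_↭_; ↭-sym; ↭-trans; ↭-refl; ↭-reflexive; prep; ↭⇒↭ₛ)
open import Data.List.Relation.Binary.Permutation.Propositional.Properties as Perm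
  using (↭-length; ++⁺; ++⁺ˡ; shift; ∈-resp-↭; ↭-empty-inv)
open import Data.List.Membership.Propositional using () renaming (_∈_ to _∈ₗ_)
open import Data.List.Membership.Propositional.Properties
  using (∈-++⁺ˡ; ∈-++⁺ʳ; ∈-++⁻; ∈-map⁺; ∈-map⁻; ∈-filter⁺; ∈-filter⁻; ∈-allFin)
open import Data.Integer as ℤ using (ℤ; +_; -[1+_]; +≤+)
open import Data.Integer.Properties using (≤-decTotalOrder; ≮⇒≥; ≤⇒≯)
open import Data.List.Sort ≤-decTotalOrder using (sort; sort-↭; sort-↗)
open import Data.List.Relation.Unary.Sorted.TotalOrder.Properties using (↗↭↗⇒≋)
open import Relation.Binary.Bundles using (DecTotalOrder)
open import Data.Product using (Σ; _,_; proj₁; proj₂)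
open import Data.Sum using (inj₁; inj₂)
open import Data.Empty using (⊥; ⊥-elim)
open import Data.Unit using (⊤; tt)
open import Function.Base using (id)
open import Function.Bundles using (mk⇔; Equivalence)
open import Relation.Binary.PropositionalEquality
  using (_≢_; refl; sym; trans; cong; cong₂; subst; module ≡-Reasoning)

module _ {A : Set} where

  lastOf : A → List A → A
  lastOf z [] = z
  lastOf z (x ∷ xs) = lastOf x xs

  lastOf-++ : ∀ z (xs : List A) y ys → lastOf z (xs ++ y ∷ ys) ≡ lastOf y ys
  lastOf-++ z [] y ys = refl
  lastOf-++ z (x ∷ xs) y ys = lastOf-++ x xs y ys

  ++-injectiveˡ : ∀ (a b c d : List A) → length a ≡ length c → a ++ b ≡ c ++ d → a ≡ c × b ≡ d
  ++-injectiveˡ [] b [] d _ e = refl , e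
  ++-injectiveˡ (x ∷ a) b (y ∷ c) d l e with refl , e′ ← ∷-injective e
    with refl , refl ← ++-injectiveˡ a b c d (ℕP.suc-injective l) e′ = refl , refl

  ++-injectiveʳ : ∀ (a b c d : List A) → length b ≡ length d → a ++ b ≡ c ++ d → a ≡ c × b ≡ d
  ++-injectiveʳ a b c d l e = ++-injectiveˡ a b c d (ℕP.+-cancelʳ-≡ (length b) (length a) (length c) lengths) e
    where
    lengths : length a + length b ≡ length c + length b
    lengths = trans (sym (length-++ a)) (trans (cong length e) (trans (length-++ c) (cong (ℕ._+_ (length c)) (sym l))))

  ∈⇒≢[] : ∀ {x : A} {xs} → x ∈ₗ xs → xs ≢ []
  ∈⇒≢[] () refl

  map-≢[] : ∀ {B : Set} (f : A → B) {xs} → xs ≢ [] → map f xs ≢ []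
  map-≢[] f {[]} ne _ = ne refl
  map-≢[] f {_ ∷ _} _ ()

module _ {A : Set} {R : A → A → Set} where

  linked-suffix : ∀ (xs : List A) {ys} → Linked R (xs ++ ys) → Linked R ys
  linked-suffix [] l = l
  linked-suffix (x ∷ []) [-] = []
  linked-suffix (x ∷ []) (_ ∷ l) = l
  linked-suffix (x ∷ y ∷ xs) (_ ∷ l) = linked-suffix (y ∷ xs) l

  linked-prefix : ∀ (xs : List A) {ys} → Linked R (xs ++ ys) → Linked R xs
  linked-prefix [] l = []
  linked-prefix (x ∷ []) l = [-]
  linked-prefix (x ∷ y ∷ xs) (r ∷ l) = r ∷ linked-prefix (y ∷ xs) l

  linked-seam : ∀ x (xs : List A) y ys → Linked R (x ∷ xs ++ y ∷ ys) → R (lastOf x xs) y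
  linked-seam x [] y ys (r ∷ _) = r
  linked-seam x (x′ ∷ xs) y ys (_ ∷ l) = linked-seam x′ xs y ys l

  linked-join : ∀ x (xs : List A) y ys → Linked R (x ∷ xs) → Linked R (y ∷ ys) →
                R (lastOf x xs) y → Linked R ((x ∷ xs) ++ y ∷ ys)
  linked-join x [] y ys _ l r = r ∷ l
  linked-join x (x′ ∷ xs) y ys (r′ ∷ l₁) l₂ r = r′ ∷ linked-join x′ xs y ys l₁ l₂ r

  linked-splice : ∀ (as : List A) b bs cs → Linked R (as ++ b ∷ bs) → Linked R (b ∷ bs ++ cs) →
                  Linked R (as ++ b ∷ bs ++ cs)
  linked-splice [] b bs cs _ l = l
  linked-splice (a ∷ []) b bs cs (r ∷ _) l = r ∷ l
  linked-splice (a ∷ a′ ∷ as) b bs cs (r ∷ l₁) l₂ = r ∷ linked-splice (a′ ∷ as) b bs cs l₁ l₂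

  -- Three lists are linked in a row iff both overlapping pairs are, provided
  -- the middle one is nonempty (it carries the link between the outer two).
  linked-glue : ∀ (as bs cs : List A) → bs ≢ [] →
                Linked R (as ++ bs ++ cs) ⇔ (Linked R (as ++ bs) × Linked R (bs ++ cs))
  linked-glue as [] cs bs≢[] = ⊥-elim (bs≢[] refl)
  linked-glue as (b ∷ bs) cs _ =
    mk⇔ (λ l → linked-prefix (as ++ b ∷ bs) (subst (Linked R) (sym (++-assoc as (b ∷ bs) cs)) l) , linked-suffix as l)
        (λ (l₁ , l₂) → linked-splice as b bs cs l₁ l₂)

Sorted : List ℤ → Set
Sorted = Linked ℤ._≤_

-- The sorted arrangement of a list is unique.
sort≡⇔Sorted : ∀ {xs T} → T ↭ xs → sort xs ≡ T ⇔ Sorted T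
sort≡⇔Sorted {xs} {T} T↭xs = mk⇔ (λ e → subst Sorted e (sort-↗ xs)) unique
  where
  unique : Sorted T → sort xs ≡ T
  unique sT = Pointwise.Pointwise-≡⇒≡
    (↗↭↗⇒≋ (DecTotalOrder.totalOrder ≤-decTotalOrder) (sort-↗ xs) sT
      (↭⇒↭ₛ (↭-trans (sort-↭ xs) (↭-sym T↭xs))))

length-sort : ∀ xs → length (sort xs) ≡ length xs
length-sort xs = ↭-length (sort-↭ xs)

sort-≡[] : ∀ {xs} → sort xs ≡ [] → xs ≡ []
sort-≡[] {xs} e = ↭-empty-inv (↭-trans (↭-sym (sort-↭ xs)) (↭-reflexive e))

sort-≢[] : ∀ {xs} → xs ≢ [] → sort xs ≢ []
sort-≢[] xs≢[] e = xs≢[] (sort-≡[] e)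

-- `stack Ys` sorts every block of Ys and concatenates them from the last block
-- to the first: this is the shape of Φ.

stack : List (List ℤ) → List ℤ
stack [] = []
stack (Y ∷ Ys) = stack Ys ++ sort Y

stack-cong : ∀ {L L′ : List (List ℤ)} → Pointwise _↭_ L L′ → stack L ≡ stack L′
stack-cong [] = refl
stack-cong {Y ∷ L} {Y′ ∷ L′} (Y↭Y′ ∷ p) =
  cong₂ _++_ (stack-cong p) (sym (Equivalence.from (sort≡⇔Sorted (↭-trans (sort-↭ Y) Y↭Y′)) (sort-↗ Y)))

-- `merge I acc Ys`: the blocks acc, Ys, where a set bit I[i] glues the block
-- after position i onto the current one (the current block accumulates in acc).
merge : ∀ {A : Set} {k} → Vec Bool k → List A → List (List A) → List (List A)
merge V.[] acc _ = acc ∷ []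
merge (b V.∷ I) acc [] = acc ∷ []
merge (false V.∷ I) acc (Y ∷ Ys) = acc ∷ merge I Y Ys
merge (true V.∷ I) acc (Y ∷ Ys) = merge I (Y ++ acc) Ys

merge-map : ∀ {A B : Set} {k} (f : A → B) (I : Vec Bool k) acc Ys →
            map (map f) (merge I acc Ys) ≡ merge I (map f acc) (map (map f) Ys)
merge-map f V.[] acc Ys = refl
merge-map f (b V.∷ I) acc [] = refl
merge-map f (false V.∷ I) acc (Y ∷ Ys) = cong (map f acc ∷_) (merge-map f I Y Ys)
merge-map f (true V.∷ I) acc (Y ∷ Ys) =
  trans (merge-map f I (Y ++ acc) Ys) (cong (λ Z → merge I Z (map (map f) Ys)) (map-++ f Y acc))

InitNonEmpty : List ℤ → List (List ℤ) → Set
InitNonEmpty Yt [] = ⊤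
InitNonEmpty Yt (Y ∷ Ys) = Yt ≢ [] × InitNonEmpty Y Ys

SortedJoins : ∀ {k} → Vec Bool k → List ℤ → List (List ℤ) → Set
SortedJoins V.[] _ _ = ⊤
SortedJoins (b V.∷ I) _ [] = ⊤
SortedJoins (false V.∷ I) Yt (Y ∷ Ys) = SortedJoins I Y Ys
SortedJoins (true V.∷ I) Yt (Y ∷ Ys) = Sorted (sort Y ++ sort Yt) × SortedJoins I Y Ys

-- Invariant of the
-- induction: acc is the union of the current group of blocks, Yt its latest
-- block, and T = sort Yt ++ T₀ the group's part of the unmerged stack.
merge-stack : ∀ {k} (I : Vec Bool k) (acc T T₀ Yt : List ℤ) (Ys : List (List ℤ)) →
              length Ys ≡ k → InitNonEmpty Yt Ys → T ↭ acc → T ≡ sort Yt ++ T₀ →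
              stack (merge I acc Ys) ≡ stack Ys ++ T ⇔ (Sorted T × SortedJoins I Yt Ys)
merge-stack V.[] acc T T₀ Yt [] _ _ T↭acc _ =
  mk⇔ (λ e → Equivalence.to (sort≡⇔Sorted T↭acc) e , tt) (λ (sT , _) → Equivalence.from (sort≡⇔Sorted T↭acc) sT)
merge-stack (false V.∷ I) acc T T₀ Yt (Y ∷ Ys) len (_ , ne) T↭acc _ = mk⇔ to from
  where
  module IH = Equivalence (merge-stack I Y (sort Y) [] Y Ys (ℕP.suc-injective len) ne (sort-↭ Y) (sym (++-identityʳ _)))
  module Last = Equivalence (sort≡⇔Sorted T↭acc)
  to : stack (merge I Y Ys) ++ sort acc ≡ (stack Ys ++ sort Y) ++ T → Sorted T × SortedJoins I Y Ys
  to e with e₁ , e₂ ← ++-injectiveʳ _ _ _ _ (trans (length-sort acc) (↭-length (↭-sym T↭acc))) e =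
    Last.to e₂ , proj₂ (IH.to e₁)
  from : Sorted T × SortedJoins I Y Ys → stack (merge I Y Ys) ++ sort acc ≡ (stack Ys ++ sort Y) ++ T
  from (sT , joins) = cong₂ _++_ (IH.from (sort-↗ Y , joins)) (Last.from sT)
merge-stack (true V.∷ I) acc T T₀ Yt (Y ∷ Ys) len (Yt≢[] , ne) T↭acc refl = mk⇔ to from
  where
  module IH = Equivalence (merge-stack I (Y ++ acc) (sort Y ++ T) T Y Ys (ℕP.suc-injective len) ne (++⁺ (sort-↭ Y) T↭acc) refl)
  module Glue = Equivalence (linked-glue (sort Y) (sort Yt) T₀ (sort-≢[] Yt≢[]))
  to : stack (merge I (Y ++ acc) Ys) ≡ (stack Ys ++ sort Y) ++ T → Sorted T × (Sorted (sort Y ++ sort Yt) × SortedJoins I Y Ys)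
  to e with sYT , joins ← IH.to (trans e (++-assoc (stack Ys) (sort Y) T))
       with sYYt , sT ← Glue.to sYT = sT , sYYt , joins
  from : Sorted T × (Sorted (sort Y ++ sort Yt) × SortedJoins I Y Ys) → stack (merge I (Y ++ acc) Ys) ≡ (stack Ys ++ sort Y) ++ T
  from (sT , sYYt , joins) = trans (IH.from (Glue.from (sYYt , sT) , joins)) (sym (++-assoc (stack Ys) (sort Y) T))

StartsBelow : ℤ → List ℤ → Set
StartsBelow z [] = ⊥
StartsBelow z (y ∷ _) = y ℤ.< z

NonNeg : ℤ → Set
NonNeg x = + 0 ℤ.≤ x

desAt-boundary : ∀ z P Q → DesAt (z ∷ P ++ Q) (length P) ≡ StartsBelow (lastOf z P) Q
desAt-boundary z [] [] = refl
desAt-boundary z [] (y ∷ Q) = refl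
desAt-boundary z (p ∷ P) Q = desAt-boundary p P Q

desAt-++⁺ : ∀ xs ys d → DesAt xs d → DesAt (xs ++ ys) d
desAt-++⁺ (x ∷ y ∷ xs) ys zero h = h
desAt-++⁺ (x ∷ y ∷ xs) ys (suc d) h = desAt-++⁺ (y ∷ xs) ys d h

desAt-++⁻ : ∀ xs ys d → suc d ℕ.< length xs → DesAt (xs ++ ys) d → DesAt xs d
desAt-++⁻ (x ∷ y ∷ xs) ys zero lt h = h
desAt-++⁻ (x ∷ []) ys d (s≤s ()) h
desAt-++⁻ (x ∷ y ∷ xs) ys (suc d) (s≤s lt) h = desAt-++⁻ (y ∷ xs) ys d lt h

seam-noDescent : ∀ z P S T → Sorted (S ++ T) → (S ≡ [] → ¬ StartsBelow (lastOf z P) T) →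
                 ¬ StartsBelow (lastOf z (P ++ S)) T
seam-noDescent z P [] T _ h rewrite ++-identityʳ P = h refl
seam-noDescent z P (s ∷ S) (t ∷ T) l _ rewrite lastOf-++ z P s S = ≤⇒≯ (linked-seam s S t T l)

seam-sorted : ∀ z P S T → Sorted S → Sorted T → ¬ StartsBelow (lastOf z (P ++ S)) T → Sorted (S ++ T)
seam-sorted z P [] T _ sT _ = sT
seam-sorted z P (s ∷ S) [] sS _ _ rewrite ++-identityʳ S = sS
seam-sorted z P (s ∷ S) (t ∷ T) sS sT h rewrite lastOf-++ z P s S = linked-join s S t T sS sT (≮⇒≥ h)

length-stack-drop : ∀ j Ys → length (stack (drop j Ys)) ℕ.≤ length (stack Ys)
length-stack-drop zero Ys = ℕP.≤-refl
length-stack-drop (suc j) [] = ℕP.≤-refl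
length-stack-drop (suc j) (Y ∷ Ys) = ℕP.≤-trans (length-stack-drop j Ys)
  (ℕP.≤-trans (ℕP.m≤m+n (length (stack Ys)) (length (sort Y))) (ℕP.≤-reflexive (sym (length-++ (stack Ys)))))

NoMergeDescents : ∀ {k} → Vec Bool k → List ℤ → List (List ℤ) → Set
NoMergeDescents {k} I Yt Ys =
  ∀ (i : Fin k) → I [ i ]= true → ¬ DesAt (+ 0 ∷ stack (Yt ∷ Ys)) (length (stack (drop (toℕ i) Ys)))

-- The seam at position 0: if the last merge point joins an empty last block,
-- the block below it has only nonnegative entries.
TopEdge : ∀ {k} → Vec Bool k → List ℤ → List (List ℤ) → Set
TopEdge V.[] _ _ = ⊤
TopEdge (b V.∷ I) Yt [] = ⊤
TopEdge (b V.∷ V.[]) Yt (Y ∷ Ys) = b ≡ true → Y ≡ [] → ∀ x → x ∈ₗ Yt → NonNeg x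
TopEdge (b V.∷ b′ V.∷ I) Yt (Y ∷ Ys) = TopEdge (b′ V.∷ I) Y Ys

noMergeDescents⇒sortedJoins : ∀ {k} (I : Vec Bool k) Yt Ys → NoMergeDescents I Yt Ys → SortedJoins I Yt Ys
noMergeDescents⇒sortedJoins V.[] Yt Ys h = tt
noMergeDescents⇒sortedJoins (b V.∷ I) Yt [] h = tt
noMergeDescents⇒sortedJoins (false V.∷ I) Yt (Y ∷ Ys) h =
  noMergeDescents⇒sortedJoins I Y Ys (λ i m d → h (Fin.suc i) (there m) (desAt-++⁺ (+ 0 ∷ stack (Y ∷ Ys)) (sort Yt) _ d))
noMergeDescents⇒sortedJoins (true V.∷ I) Yt (Y ∷ Ys) h =
  seam-sorted (+ 0) (stack Ys) (sort Y) (sort Yt) (sort-↗ Y) (sort-↗ Yt)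
    (λ d → h Fin.zero here (subst id (sym (desAt-boundary (+ 0) (stack Ys ++ sort Y) (sort Yt))) d))
  , noMergeDescents⇒sortedJoins I Y Ys (λ i m d → h (Fin.suc i) (there m) (desAt-++⁺ (+ 0 ∷ stack (Y ∷ Ys)) (sort Yt) _ d))

-- An empty block can only be the last one; the seam below it is then covered by TopEdge.
emptyBlock-noDescent : ∀ {k} (I : Vec Bool k) Yt Y Ys → length Ys ≡ k → InitNonEmpty Y Ys →
                       TopEdge (true V.∷ I) Yt (Y ∷ Ys) → Y ≡ [] → ¬ StartsBelow (lastOf (+ 0) (stack Ys)) (sort Yt)
emptyBlock-noDescent V.[] Yt Y [] _ _ edge Y≡[] with sort Yt | sort-↭ Yt
... | t ∷ _ | p = ≤⇒≯ (edge refl Y≡[] t (∈-resp-↭ p (here refl)))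
emptyBlock-noDescent I Yt Y (_ ∷ _) _ (Y≢[] , _) _ Y≡[] = ⊥-elim (Y≢[] Y≡[])

sortedJoins⇒noMergeDescents : ∀ {k} (I : Vec Bool k) Yt Ys → length Ys ≡ k → InitNonEmpty Yt Ys →
                              SortedJoins I Yt Ys → TopEdge I Yt Ys → NoMergeDescents I Yt Ys
sortedJoins⇒noMergeDescents (true V.∷ I) Yt (Y ∷ Ys) len (_ , ne) (sYYt , _) edge Fin.zero here d =
  seam-noDescent (+ 0) (stack Ys) (sort Y) (sort Yt) sYYt emptySeam
    (subst id (desAt-boundary (+ 0) (stack Ys ++ sort Y) (sort Yt)) d)
  where
  emptySeam : sort Y ≡ [] → ¬ StartsBelow (lastOf (+ 0) (stack Ys)) (sort Yt)
  emptySeam Y≡[] = emptyBlock-noDescent I Yt Y Ys (ℕP.suc-injective len) ne edge (sort-≡[] Y≡[])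
sortedJoins⇒noMergeDescents (b V.∷ b′ V.∷ I) Yt (Y ∷ Ys@(_ ∷ _)) len (_ , ne@(Y≢[] , _)) joins edge (Fin.suc i) (there m) d =
  IH (desAt-++⁻ (+ 0 ∷ stack (Y ∷ Ys)) (sort Yt) _ (s≤s inside) d)
  where
  IH = sortedJoins⇒noMergeDescents (b′ V.∷ I) Y Ys (ℕP.suc-injective len) ne (joinsTail b joins) edge i m
    where
    joinsTail : ∀ b → SortedJoins (b V.∷ b′ V.∷ I) Yt (Y ∷ Ys) → SortedJoins (b′ V.∷ I) Y Ys
    joinsTail false js = js
    joinsTail true js = proj₂ js
  inside : length (stack (drop (toℕ i) Ys)) ℕ.< length (stack Ys ++ sort Y)
  inside = ℕP.≤-trans (s≤s (length-stack-drop (toℕ i) Ys))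
    (ℕP.≤-trans (ℕP.≤-reflexive (ℕP.+-comm 1 (length (stack Ys))))
      (ℕP.≤-trans (ℕP.+-monoʳ-≤ (length (stack Ys)) (nonempty (sort Y) (sort-≢[] Y≢[])))
        (ℕP.≤-reflexive (sym (length-++ (stack Ys))))))
    where
    nonempty : ∀ (xs : List ℤ) → xs ≢ [] → 1 ℕ.≤ length xs
    nonempty [] ne = ⊥-elim (ne refl)
    nonempty (_ ∷ _) _ = s≤s z≤n

-- TopEdge follows if the last merged block is nonnegative (the block below
-- the final merge point is part of it).
topEdge-from-last : ∀ {k} (I : Vec Bool k) acc Yt Ys z → (∀ x → x ∈ₗ Yt → x ∈ₗ acc) →
                    (∀ x → x ∈ₗ lastOf z (merge I acc Ys) → NonNeg x) → TopEdge I Yt Ys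
topEdge-from-last V.[] acc Yt Ys z sub h = tt
topEdge-from-last (b V.∷ I) acc Yt [] z sub h = tt
topEdge-from-last (true V.∷ V.[]) acc Yt (Y ∷ Ys) z sub h = λ _ _ x m → h x (∈-++⁺ʳ Y (sub x m))
topEdge-from-last (false V.∷ V.[]) acc Yt (Y ∷ Ys) z sub h = λ ()
topEdge-from-last (false V.∷ b′ V.∷ I) acc Yt (Y ∷ Ys) z sub h =
  topEdge-from-last (b′ V.∷ I) Y Y Ys acc (λ x m → m) h
topEdge-from-last (true V.∷ b′ V.∷ I) acc Yt (Y ∷ Ys) z sub h =
  topEdge-from-last (b′ V.∷ I) (Y ++ acc) Y Ys z (λ x m → ∈-++⁺ˡ m) h

isZero⇒zer : ∀ x → isZero x ≡ true → x ≡ zer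
isZero⇒zer zer _ = refl

zer⇒isZero : ∀ x → x ≡ zer → isZero x ≡ true
zer⇒isZero zer _ = refl

≢zer⇒isZero : ∀ x → x ≢ zer → isZero x ≡ false
≢zer⇒isZero neg _ = refl
≢zer⇒isZero pos _ = refl
≢zer⇒isZero zer h = ⊥-elim (h refl)

negate-zer : ∀ x → negate x ≡ zer → x ≡ zer
negate-zer zer _ = refl

filter-∨ : ∀ {A : Set} (f g h : A → Bool) → (∀ x → f x ≡ g x ∨ h x) → (∀ x → g x ∧ h x ≡ false) →
           ∀ xs → filter (λ x → f x Bool.≟ true) xs ↭ filter (λ x → g x Bool.≟ true) xs ++ filter (λ x → h x Bool.≟ true) xs
filter-∨ f g h f≡ disj [] = ↭-refl
filter-∨ f g h f≡ disj (x ∷ xs) with f x | g x | h x | f≡ x | disj x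
... | true | true | false | _ | _ = prep x (filter-∨ f g h f≡ disj xs)
... | true | false | true | _ | _ = ↭-trans (prep x (filter-∨ f g h f≡ disj xs)) (↭-sym (shift x _ _))
... | false | false | false | _ | _ = filter-∨ f g h f≡ disj xs
... | true | true | true | _ | ()
... | true | false | false | () | _
... | false | true | _ | () | _
... | false | false | true | () | _

nonzeroEntry : ∀ {n} (ω : SignVec n) → NonZeroVec ω → Σ (Fin n) (λ i → lookup ω i ≢ zer)
nonzeroEntry V.[] h = ⊥-elim (h refl)
nonzeroEntry (neg V.∷ ω) h = Fin.zero , λ ()
nonzeroEntry (pos V.∷ ω) h = Fin.zero , λ ()
nonzeroEntry (zer V.∷ ω) h with i , q ← nonzeroEntry ω (λ e → h (cong (zer V.∷_) e)) = Fin.suc i , q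

module _ {n : ℕ} where

  positions : (Fin n → Bool) → List (Fin n)
  positions t = filter (λ i → t i Bool.≟ true) (allFin n)

  zeroSet : SignVec n → List (Fin n)
  zeroSet p = positions (λ i → isZero (lookup p i))

  -- the positions that are zero in p but not in ω: the block I_s for p = ω^(s-1), ω = ω^(s)
  newSupport : SignVec n → SignVec n → List (Fin n)
  newSupport p ω = positions (λ i → not (isZero (lookup ω i)) ∧ isZero (lookup p i))

  _⊑_ : SignVec n → SignVec n → Set
  p ⊑ ω = ∀ i → isZero (lookup ω i) ≡ true → isZero (lookup p i) ≡ true

  ≺⇒⊑ : ∀ {ω′ ω : SignVec n} → ω′ ≺ ω → ω′ ⊑ ω
  ≺⇒⊑ {ω′} {ω} (inj₁ z , _) i e with z i
  ... | inj₁ q = zer⇒isZero _ q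
  ... | inj₂ q = zer⇒isZero _ (trans q (isZero⇒zer _ e))
  ≺⇒⊑ {ω′} {ω} (inj₂ z , _) i e = zer⇒isZero _ (negate-zer _ (trans (sym (VP.lookup-map i negate ω′)) q))
    where
    q : lookup (negVec ω′) i ≡ zer
    q with z i
    ... | inj₁ q = q
    ... | inj₂ q = trans q (isZero⇒zer _ e)

  zeroVec-isZero : ∀ i → isZero (lookup (zeroVec n) i) ≡ true
  zeroVec-isZero i rewrite VP.lookup-replicate i zer = refl

  ∈-newSupport : ∀ {p ω : SignVec n} i → lookup p i ≡ zer → lookup ω i ≢ zer → i ∈ₗ newSupport p ω
  ∈-newSupport {p} {ω} i p0 ω≢0 = ∈-filter⁺ _ (∈-allFin i) eq
    where
    eq : not (isZero (lookup ω i)) ∧ isZero (lookup p i) ≡ true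
    eq rewrite ≢zer⇒isZero _ ω≢0 | zer⇒isZero _ p0 = refl

  ≺⇒newSupport≢[] : ∀ {ω′ ω : SignVec n} → ω′ ≺ ω → newSupport ω′ ω ≢ []
  ≺⇒newSupport≢[] {ω′} {ω} (_ , i , z , nz) = ∈⇒≢[] (∈-newSupport {ω′} {ω} i z nz)

  nonZero⇒newSupport≢[] : ∀ (ω : SignVec n) → NonZeroVec ω → newSupport (zeroVec n) ω ≢ []
  nonZero⇒newSupport≢[] ω ω≢0 with i , q ← nonzeroEntry ω ω≢0 =
    ∈⇒≢[] (∈-newSupport {zeroVec n} {ω} i (VP.lookup-replicate i zer) q)

  zeroSet-split : ∀ p ω → p ⊑ ω → zeroSet p ↭ zeroSet ω ++ newSupport p ω
  zeroSet-split p ω p⊑ω = filter-∨ _ _ _ cover disjoint (allFin n)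
    where
    cover : ∀ i → isZero (lookup p i) ≡ isZero (lookup ω i) ∨ (not (isZero (lookup ω i)) ∧ isZero (lookup p i))
    cover i with isZero (lookup ω i) in e
    ... | true = p⊑ω i e
    ... | false = refl
    disjoint : ∀ i → isZero (lookup ω i) ∧ (not (isZero (lookup ω i)) ∧ isZero (lookup p i)) ≡ false
    disjoint i with isZero (lookup ω i)
    ... | true = refl
    ... | false = refl

  newSupport-split : ∀ p ω ω′ → p ⊑ ω → ω ⊑ ω′ → newSupport p ω′ ↭ newSupport ω ω′ ++ newSupport p ω
  newSupport-split p ω ω′ p⊑ω ω⊑ω′ = filter-∨ _ _ _ cover disjoint (allFin n)
    where
    cover : ∀ i → not (isZero (lookup ω′ i)) ∧ isZero (lookup p i) ≡
                  (not (isZero (lookup ω′ i)) ∧ isZero (lookup ω i)) ∨ (not (isZero (lookup ω i)) ∧ isZero (lookup p i))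
    cover i with isZero (lookup ω′ i) in e′ | isZero (lookup ω i) in e | isZero (lookup p i) in ep
    ... | true | true | _ = refl
    ... | true | false | _ with () ← trans (sym e) (ω⊑ω′ i e′)
    cover i | false | true | true = refl
    cover i | false | true | false with () ← trans (sym ep) (p⊑ω i e)
    cover i | false | false | _ = refl
    disjoint : ∀ i → (not (isZero (lookup ω′ i)) ∧ isZero (lookup ω i)) ∧ (not (isZero (lookup ω i)) ∧ isZero (lookup p i)) ≡ false
    disjoint i with isZero (lookup ω′ i) | isZero (lookup ω i)
    ... | true | _ = refl
    ... | false | true = refl
    ... | false | false = refl

  subchain-blocks : ∀ {k} (p w : SignVec n) (ws : Vec (SignVec n) k) (I : Subset (suc k)) (acc : List (Fin n)) →
                    p ⊑ w → ChainFrom w (toList ws) → acc ↭ newSupport p w →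
                    Pointwise _↭_ (blocksFrom p (removeIdx I (w V.∷ ws))) (merge I acc (blocksFrom w (toList ws)))
  subchain-blocks p w V.[] (false V.∷ V.[]) acc _ _ a = ↭-sym a ∷ ↭-refl ∷ []
  subchain-blocks p w V.[] (true V.∷ V.[]) acc p⊑w _ a = ↭-trans (zeroSet-split p w p⊑w) (++⁺ˡ (zeroSet w) (↭-sym a)) ∷ []
  subchain-blocks p w (w₂ V.∷ ws) (false V.∷ I) acc _ (w≺w₂ , ch) a =
    ↭-sym a ∷ subchain-blocks w w₂ ws I (newSupport w w₂) (≺⇒⊑ {w} {w₂} w≺w₂) ch ↭-refl
  subchain-blocks p w (w₂ V.∷ ws) (true V.∷ I) acc p⊑w (w≺w₂ , ch) a =
    subchain-blocks p w₂ ws I (newSupport w w₂ ++ acc) p⊑w₂ ch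
      (↭-sym (↭-trans (newSupport-split p w w₂ p⊑w (≺⇒⊑ {w} {w₂} w≺w₂)) (++⁺ˡ (newSupport w w₂) (↭-sym a))))
    where
    p⊑w₂ : p ⊑ w₂
    p⊑w₂ i e = p⊑w i (≺⇒⊑ {w} {w₂} w≺w₂ i e)

labelled : ∀ {n} → (Fin n → ℤ) → List (List (Fin n)) → List (List ℤ)
labelled f = map (map f)

Φ-as-stack : ∀ {n} (C : List (SignVec n)) → Φ C ≡ stack (labelled (signedLabel (BAR (top C))) (blocks C))
Φ-as-stack C = go (blocks C)
  where
  open ≡-Reasoning
  f = signedLabel (BAR (top C))
  g = λ X → sort (map f X)
  go : ∀ L → concat (reverse (map g L)) ≡ stack (labelled f L)
  go [] = refl
  go (X ∷ L) = begin
      concat (reverse (g X ∷ map g L))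
    ≡⟨ cong concat (unfold-reverse (g X) (map g L)) ⟩
      concat (reverse (map g L) ++ (g X ∷ []))
    ≡⟨ sym (concat-++ (reverse (map g L)) (g X ∷ [])) ⟩
      concat (reverse (map g L)) ++ (g X ++ [])
    ≡⟨ cong₂ _++_ (go L) (++-identityʳ (g X)) ⟩
      stack (labelled f L) ++ g X
    ∎

ℓ-as-stack : ∀ {n} (f : Fin n → ℤ) X (L : List (List (Fin n))) j →
             length (concat (drop (suc j) (X ∷ L))) ≡ length (stack (drop j (labelled f L)))
ℓ-as-stack f X L j = trans (lengths (drop j L)) (cong (λ Z → length (stack Z)) (sym (drop-map j L)))
  where
  open ≡-Reasoning
  lengths : ∀ L → length (concat L) ≡ length (stack (labelled f L))
  lengths [] = refl
  lengths (X ∷ L) = begin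
      length (X ++ concat L)
    ≡⟨ length-++ X ⟩
      length X + length (concat L)
    ≡⟨ cong₂ _+_ (trans (sym (length-map f X)) (sym (length-sort (map f X)))) (lengths L) ⟩
      length (sort (map f X)) + length (stack (labelled f L))
    ≡⟨ ℕP.+-comm (length (sort (map f X))) _ ⟩
      length (stack (labelled f L)) + length (sort (map f X))
    ≡⟨ sym (length-++ (stack (labelled f L))) ⟩
      length (stack (labelled f L) ++ sort (map f X))
    ∎

length-blocksFrom : ∀ {n} (p : SignVec n) xs → length (blocksFrom p xs) ≡ suc (length xs)
length-blocksFrom p [] = refl
length-blocksFrom p (x ∷ xs) = cong suc (length-blocksFrom x xs)

chain-initNonEmpty : ∀ {n} (f : Fin n → ℤ) (p w : SignVec n) xs → newSupport p w ≢ [] → ChainFrom w xs →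
                     InitNonEmpty (map f (newSupport p w)) (labelled f (blocksFrom w xs))
chain-initNonEmpty f p w [] ne _ = map-≢[] f ne , tt
chain-initNonEmpty f p w (w₂ ∷ xs) ne (w≺w₂ , ch) =
  map-≢[] f ne , chain-initNonEmpty f w w₂ xs (≺⇒newSupport≢[] {_} {w} {w₂} w≺w₂) ch

label∈stack : ∀ {n} (f : Fin n → ℤ) (p : SignVec n) xs i → isZero (lookup p i) ≡ true →
              f i ∈ₗ stack (labelled f (blocksFrom p xs))
label∈stack f p [] i e = ∈-resp-↭ (↭-sym (sort-↭ _)) (∈-map⁺ f (∈-filter⁺ _ (∈-allFin i) e))
label∈stack f p (w ∷ xs) i e with isZero (lookup w i) in e′
... | true = ∈-++⁺ˡ (label∈stack f w xs i e′)
... | false = ∈-++⁺ʳ (stack (labelled f (blocksFrom w xs)))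
                (∈-resp-↭ (↭-sym (sort-↭ _)) (∈-map⁺ f (∈-filter⁺ _ (∈-allFin i) new)))
  where
  new : not (isZero (lookup w i)) ∧ isZero (lookup p i) ≡ true
  new rewrite e′ | e = refl

stack-labels : ∀ {n} (f : Fin n → ℤ) (L : List (List (Fin n))) x → x ∈ₗ stack (labelled f L) → Σ (Fin n) (λ j → x ≡ f j)
stack-labels f (X ∷ L) x m with ∈-++⁻ (stack (labelled f L)) m
... | inj₁ m′ = stack-labels f L x m′
... | inj₂ m′ with j , _ , eq ← ∈-map⁻ f (∈-resp-↭ (sort-↭ _) m′) = j , eq

signedLabel-bit : ∀ {n} (b₁ b₀ : Subset n) i j → signedLabel b₁ i ≡ signedLabel b₀ j → lookup b₁ i ≡ lookup b₀ i
signedLabel-bit b₁ b₀ i j eq with lookup b₁ i in e₁ | lookup b₀ j in e₀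
... | true | true = trans (sym e₀) (cong (lookup b₀) (sym (FinP.toℕ-injective (negSuc-injective eq))))
  where
  negSuc-injective : ∀ {a c} → -[1+ a ] ≡ -[1+ c ] → a ≡ c
  negSuc-injective refl = refl
... | false | false = trans (sym e₀) (cong (lookup b₀) (sym (FinP.toℕ-injective (ℕP.suc-injective (pos-injective eq)))))
  where
  pos-injective : ∀ {a c} → + a ≡ + c → a ≡ c
  pos-injective refl = refl
... | true | false with () ← eq
... | false | true with () ← eq

positive-label : ∀ {n} (b : Subset n) i → lookup b i ≡ false → NonNeg (signedLabel b i)
positive-label b i e rewrite e = +≤+ z≤n

-- (4) Equal Φ forces equal BAR of the tops: each position appears in both
-- words, and its sign there is its BAR bit.
Φ-determines-BAR : ∀ {n} (C′ C : List (SignVec n)) → Φ C′ ≡ Φ C → BAR (top C′) ≡ BAR (top C)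
Φ-determines-BAR {n} C′ C eq = VP.tabulate-cong λ i →
  trans (sym (VP.lookup∘tabulate (isFlip (top C′)) i))
    (trans (sameBit i) (VP.lookup∘tabulate (isFlip (top C)) i))
  where
  sameBit : ∀ i → lookup (BAR (top C′)) i ≡ lookup (BAR (top C)) i
  sameBit i with j , e ← stack-labels (signedLabel (BAR (top C))) (blocks C) _
                   (subst (signedLabel (BAR (top C′)) i ∈ₗ_) (trans (sym (Φ-as-stack C′)) (trans eq (Φ-as-stack C)))
                     (label∈stack _ (zeroVec n) C′ i (zeroVec-isZero i)))
    = signedLabel-bit (BAR (top C′)) (BAR (top C)) i j e

zero-notFlip : ∀ {n} (q : SignVec n) i → isZero (lookup q i) ≡ true → lookup (BAR q) i ≡ false
zero-notFlip {n} q i e = trans (VP.lookup∘tabulate (isFlip q) i) search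
  where
  search-zer : ∀ i j fuel → flipSearch q i zer j fuel ≡ false
  search-zer i j zero = refl
  search-zer i j (suc fuel) with cyc q (i + (n ∸ 1) ℕ.* j)
  ... | zer = search-zer i (suc j) fuel
  ... | neg = refl
  ... | pos = refl
  search : flipSearch q (toℕ i) (lookup q i) 1 n ≡ false
  search rewrite isZero⇒zer (lookup q i) e = search-zer (toℕ i) 1 n

top-lastOf : ∀ {n} (L : List (SignVec n)) → top L ≡ lastOf (zeroVec n) L
top-lastOf [] = refl
top-lastOf (x ∷ []) = refl
top-lastOf (x ∷ y ∷ L) = top-lastOf (y ∷ L)

lastOf-blocksFrom : ∀ {n} z (p : SignVec n) xs → lastOf z (blocksFrom p xs) ≡ zeroSet (lastOf p xs)
lastOf-blocksFrom z p [] = refl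
lastOf-blocksFrom z p (w ∷ xs) = lastOf-blocksFrom _ w xs

lastOf-pointwise : ∀ {A : Set} {R : A → A → Set} {z z′ L L′} → R z z′ → Pointwise R L L′ → R (lastOf z L) (lastOf z′ L′)
lastOf-pointwise r [] = r
lastOf-pointwise _ (r ∷ rs) = lastOf-pointwise r rs

lastOf-map : ∀ {A B : Set} (g : A → B) z L → lastOf (g z) (map g L) ≡ g (lastOf z L)
lastOf-map g z [] = refl
lastOf-map g z (x ∷ L) = lastOf-map g x L

module Chain {n k : ℕ} (w : SignVec n) (ws : Vec (SignVec n) k) (w≢0 : NonZeroVec w)
             (ch : ChainFrom w (toList ws)) (I : Subset (suc k)) where

  C : List (SignVec n)
  C = w ∷ toList ws

  C-I : List (SignVec n)
  C-I = removeIdx I (w V.∷ ws)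

  I₁ : List (Fin n)
  I₁ = newSupport (zeroVec n) w

  Ys : List (List (Fin n))
  Ys = blocksFrom w (toList ws)

  length-Ys : ∀ (f : Fin n → ℤ) → length (labelled f Ys) ≡ suc k
  length-Ys f = trans (length-map (map f) Ys) (trans (length-blocksFrom w (toList ws)) (cong suc (VP.length-toList ws)))

  blocks-initNonEmpty : ∀ (f : Fin n → ℤ) → InitNonEmpty (map f I₁) (labelled f Ys)
  blocks-initNonEmpty f = chain-initNonEmpty f (zeroVec n) w (toList ws) (nonZero⇒newSupport≢[] w w≢0) ch

  labelled-subchain-blocks : ∀ (f : Fin n → ℤ) → Pointwise _↭_ (labelled f (blocks C-I)) (merge I (map f I₁) (labelled f Ys))
  labelled-subchain-blocks f =
    subst (Pointwise _↭_ (labelled f (blocks C-I))) (merge-map f I I₁ Ys)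
      (Pointwise.map⁺ (map f) (map f)
        (Pointwise.map (Perm.map⁺ f) (subchain-blocks (zeroVec n) w ws I I₁ (λ i _ → zeroVec-isZero i) ch ↭-refl)))

  stack-iff-sortedJoins : ∀ (f : Fin n → ℤ) →
    stack (labelled f (blocks C-I)) ≡ stack (labelled f (blocks C)) ⇔ SortedJoins I (map f I₁) (labelled f Ys)
  stack-iff-sortedJoins f = mk⇔ (λ e → proj₂ (Merge.to (trans (sym mergeBlocks) e)))
                                 (λ joins → trans mergeBlocks (Merge.from (sort-↗ (map f I₁) , joins)))
    where
    mergeBlocks = stack-cong (labelled-subchain-blocks f)
    module Merge = Equivalence (merge-stack I (map f I₁) (sort (map f I₁)) [] (map f I₁) (labelled f Ys)
      (length-Ys f) (blocks-initNonEmpty f) (sort-↭ (map f I₁)) (sym (++-identityʳ _)))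

  f₀ : Fin n → ℤ
  f₀ = signedLabel (BAR (top C))

  -- (4) With BAR unchanged, Φ(C_I) is the stack of C_I labelled as for C, and
  -- the seam at position 0 is harmless: the last merged block consists of
  -- zeros of top C_I, whose labels are positive.
  Φ-subchain : BAR (top C-I) ≡ BAR (top C) → Φ C-I ≡ stack (labelled f₀ (blocks C-I))
  Φ-subchain sameBAR = trans (Φ-as-stack C-I) (cong (λ b → stack (labelled (signedLabel b) (blocks C-I))) sameBAR)

  topEdge : BAR (top C-I) ≡ BAR (top C) → TopEdge I (map f₀ I₁) (labelled f₀ Ys)
  topEdge sameBAR = topEdge-from-last I (map f₀ I₁) (map f₀ I₁) (labelled f₀ Ys) [] (λ x m → m) lastNonNeg
    where
    open ≡-Reasoning
    lastLabels : lastOf [] (labelled f₀ (blocks C-I)) ≡ map f₀ (zeroSet (top C-I))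
    lastLabels = begin
        lastOf (map f₀ []) (labelled f₀ (blocks C-I))
      ≡⟨ lastOf-map (map f₀) [] (blocks C-I) ⟩
        map f₀ (lastOf [] (blocks C-I))
      ≡⟨ cong (map f₀) (lastOf-blocksFrom [] (zeroVec n) C-I) ⟩
        map f₀ (zeroSet (lastOf (zeroVec n) C-I))
      ≡⟨ cong (λ q → map f₀ (zeroSet q)) (sym (top-lastOf C-I)) ⟩
        map f₀ (zeroSet (top C-I))
      ∎
    lastBlock : lastOf [] (merge I (map f₀ I₁) (labelled f₀ Ys)) ↭ map f₀ (zeroSet (top C-I))
    lastBlock = ↭-trans (↭-sym (lastOf-pointwise ↭-refl (labelled-subchain-blocks f₀))) (↭-reflexive lastLabels)
    lastNonNeg : ∀ x → x ∈ₗ lastOf [] (merge I (map f₀ I₁) (labelled f₀ Ys)) → NonNeg x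
    lastNonNeg x m with i , i∈ , refl ← ∈-map⁻ f₀ (∈-resp-↭ lastBlock m) =
      positive-label (BAR (top C)) i
        (trans (cong (λ b → lookup b i) (sym sameBAR)) (zero-notFlip (top C-I) i (proj₂ (∈-filter⁻ _ {xs = allFin n} i∈))))

  RemovedAvoidDes : Set
  RemovedAvoidDes = ∀ (i : Fin (suc k)) → i ∈ I → ¬ InDes (Φ C) (ℓ C (suc (toℕ i)))

  descents-at-merges : ∀ (i : Fin (suc k)) → InDes (Φ C) (ℓ C (suc (toℕ i)))
                       ≡ DesAt (+ 0 ∷ stack (labelled f₀ (blocks C))) (length (stack (drop (toℕ i) (labelled f₀ Ys))))
  descents-at-merges i = cong₂ (λ a d → DesAt (+ 0 ∷ a) d) (Φ-as-stack C) (ℓ-as-stack f₀ I₁ Ys (toℕ i))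

  avoidDes⇒sortedJoins : RemovedAvoidDes → SortedJoins I (map f₀ I₁) (labelled f₀ Ys)
  avoidDes⇒sortedJoins avoid = noMergeDescents⇒sortedJoins I (map f₀ I₁) (labelled f₀ Ys)
    (λ i i∈I d → avoid i i∈I (subst id (sym (descents-at-merges i)) d))

  sortedJoins⇒avoidDes : BAR (top C-I) ≡ BAR (top C) → SortedJoins I (map f₀ I₁) (labelled f₀ Ys) → RemovedAvoidDes
  sortedJoins⇒avoidDes sameBAR joins i i∈I d =
    sortedJoins⇒noMergeDescents I (map f₀ I₁) (labelled f₀ Ys) (length-Ys f₀) (blocks-initNonEmpty f₀)
      joins (topEdge sameBAR) i i∈I (subst id (descents-at-merges i) d)

proposition3p9 : (n m : ℕ) → 1 ≤ n → m < n → (Even m ⊎ m ≡ n ∸ 1) →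
    (k : ℕ) (C : Vec (SignVec n) k) → IsChain n m (toList C) →
    (I : Subset k) →
    (Φ (removeIdx I C) ≡ Φ (toList C))
      ⇔ ((∀ (i : Fin k) → i ∈ I → ¬ InDes (Φ (toList C)) (ℓ (toList C) (suc (toℕ i))))
         × BAR (top (removeIdx I C)) ≡ BAR (top (toList C)))
proposition3p9 n m _ _ _ zero V.[] _ V.[] = mk⇔ (λ _ → (λ ()) , refl) (λ _ → refl)
proposition3p9 n m _ _ _ (suc k) (w V.∷ ws) ((w≢0 , _) , _ , ch) I = mk⇔ fwd bwd
  where
  open Chain w ws w≢0 ch I
  module Stack = Equivalence (stack-iff-sortedJoins f₀)
  fwd : Φ C-I ≡ Φ C → RemovedAvoidDes × BAR (top C-I) ≡ BAR (top C)
  fwd eq = sortedJoins⇒avoidDes sameBAR (Stack.to stacksAgree) , sameBAR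
    where
    sameBAR = Φ-determines-BAR C-I C eq
    stacksAgree = trans (sym (Φ-subchain sameBAR)) (trans eq (Φ-as-stack C))
  bwd : RemovedAvoidDes × BAR (top C-I) ≡ BAR (top C) → Φ C-I ≡ Φ C
  bwd (avoid , sameBAR) =
    trans (Φ-subchain sameBAR) (trans (Stack.from (avoidDes⇒sortedJoins avoid)) (sym (Φ-as-stack C)))
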